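{- With the notation of the context, there is no integer $k$ with $4\le k\le m+1$ such that $w_{m+1,k}=a_k$, $w_{m+1,k-1}<a_{k-1}$, $w_{m+1,k-2}=a_{k-2}$ and $w_{m+1,k-3}>0$.
   Context: Let $a$ be a real number with infinite continued fraction expansion $[a_0;a_1,a_2,\dots]$ ($a_0\in\mathbb{Z}$, $a_i$ positive integers for $i\ge1$). Set $q_{ -1}=0$, $q_0=1$, $q_{k+1}=a_{k+1}q_k+q_{k-1}$. The Ostrowski representation of $N\in\mathbb{N}$ is the unique word $b_n\dots b_1$ with $N=\sum_{k=0}^{n}b_{k+1}q_k$, $b_k\in\mathbb{N}$, $b_1<a_1$, $b_k\le a_k$, and $b_{k-1}=0$ whenever $b_k=a_k$. A word is written $u_r\dots u_1$; $u_i$ is the entry at position $i$. Let $M,N\in\mathbb{N}$ have Ostrowski representations $x_n\dots x_1$, $y_n\dots y_1$ (padded with leading zeros to common length $n$). Let $m=n+1$, $s_i=x_i+y_i$ ($1\le i\le n$), $s_m=0$, $s=s_m\dots s_1$. Algorithm 1 defines $z_k=z_{k,m}\dots z_{k,1}$ for $k=m+1,\dots,3$ (decreasing). $z_{m+1}=s$. For $4\le k\le m$: $z_{k,i}=z_{k+1,i}$ for $i\notin\{k,k-1,k-2,k-3\}$, and (A1) if $z_{k+1,k}<a_k$, $z_{k+1,k-1}>a_{k-1}$, $z_{k+1,k-2}=0$: $(z_{k,k},z_{k,k-1},z_{k,k-2},z_{k,k-3})=(z_{k+1,k}+1,\ z_{k+1,k-1}-(a_{k-1}+1),\ a_{k-2}-1,\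 z_{k+1,k-3}+1)$; (A2) if $z_{k+1,k}<a_k$, $a_{k-1}\le z_{k+1,k-1}\le 2a_{k-1}$, $z_{k+1,k-2}>0$: $(z_{k+1,k}+1,\ z_{k+1,k-1}-a_{k-1},\ z_{k+1,k-2}-1,\ z_{k+1,k-3})$; (A3) otherwise unchanged. For $k=3$: $z_{3,i}=z_{4,i}$ for $i\notin\{1,2,3\}$, and (B1) if $z_{4,3}<a_3$, $z_{4,2}>a_2$, $z_{4,1}=0$: $(z_{3,3},z_{3,2},z_{3,1})=(z_{4,3}+1,\ z_{4,2}-(a_2+1),\ a_1-1)$; (B2) if $z_{4,3}<a_3$, $z_{4,2}\ge a_2$, $a_1\ge z_{4,1}>0$: $(z_{4,3}+1,\ z_{4,2}-a_2,\ z_{4,1}-1)$; (B3) if $z_{4,3}<a_3$, $z_{4,2}\ge a_2$, $z_{4,1}>a_1$: $(z_{4,3}+1,\ z_{4,2}-a_2+1,\ z_{4,1}-a_1-1)$; (B4) if $z_{4,2}<a_2$, $z_{4,1}\ge a_1$: $(z_{4,3},\ z_{4,2}+1,\ z_{4,1}-a_1)$; (B5) otherwise unchanged. Algorithm 2 defines $w_k=w_{k,m+1}\dots w_{k,1}$ for $k=2,3,\dots,m+1$ (increasing). $w_2=0\,z_{3,m}\dots z_{3,1}$ (so $w_{2,m+1}=0$, $w_{2,i}=z_{3,i}$ for $i\le m$). For $3\le k\le m+1$: $w_{k,i}=w_{k-1,i}$ for $i\notin\{k,k-1,k-2\}$; if $w_{k-1,k}<a_k$, $w_{k-1,k-1}=a_{k-1}$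 and $w_{k-1,k-2}>0$, then $(w_{k,k},w_{k,k-1},w_{k,k-2})=(w_{k-1,k}+1,\ 0,\ w_{k-1,k-2}-1)$; otherwise these three entries are unchanged. -}

module Defs where

open import Data.Nat using (ℕ; zero; suc; _+_; _*_; _∸_; _≤_; _<_; _≤ᵇ_; _<ᵇ_; _≡ᵇ_)
open import Data.Bool using (Bool; true; false; if_then_else_; _∧_)
open import Data.Product using (_×_)
open import Relation.Binary.PropositionalEquality using (_≡_)

-- Partial quotients: a i is a_i for i ≥ 1 (a 0 is never used).
-- Words u_r … u_1 are functions ℕ → ℕ, u i = entry at position i (position 0 unused).

-- q_k (k ≥ 0): q_0 = 1, q_1 = a_1 q_0 + q_{-1} = a_1, q_{k+2} = a_{k+2} q_{k+1} + q_k
q : (ℕ → ℕ) → ℕ → ℕ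
q a zero = 1
q a (suc zero) = a 1 * 1 + 0
q a (suc (suc k)) = a (suc (suc k)) * q a (suc k) + q a k

ostVal : (ℕ → ℕ) → ℕ → (ℕ → ℕ) → ℕ
ostVal a zero b = 0
ostVal a (suc n) b = ostVal a n b + b (suc n) * q a n

-- b_n … b_1 (possibly with leading zeros) is the Ostrowski representation of N
record IsOstrowskiRep (a : ℕ → ℕ) (n : ℕ) (b : ℕ → ℕ) (N : ℕ) : Set where
  field
    value  : N ≡ ostVal a n b
    first  : 1 ≤ n → b 1 < a 1
    bound  : ∀ k → 1 ≤ k → k ≤ n → b k ≤ a k
    zeroed : ∀ k → 2 ≤ k → k ≤ n → b k ≡ a k → b (k ∸ 1) ≡ 0

upd : (ℕ → ℕ) → ℕ → ℕ → (ℕ → ℕ)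
upd f p v i = if i ≡ᵇ p then v else f i

-- s_i = x_i + y_i for 1 ≤ i ≤ n, and 0 elsewhere (in particular s_m = 0, m = n+1)
sumWord : ℕ → (ℕ → ℕ) → (ℕ → ℕ) → (ℕ → ℕ)
sumWord n x y i = if (1 ≤ᵇ i) ∧ (i ≤ᵇ n) then x i + y i else 0

-- Algorithm 1, step k (4 ≤ k ≤ m): z_k from z = z_{k+1}
stepA : (ℕ → ℕ) → ℕ → (ℕ → ℕ) → (ℕ → ℕ)
stepA a k z =
  if (z k <ᵇ a k) ∧ (a (k ∸ 1) <ᵇ z (k ∸ 1)) ∧ (z (k ∸ 2) ≡ᵇ 0)
  then upd (upd (upd (upd z k (z k + 1)) (k ∸ 1) (z (k ∸ 1) ∸ (a (k ∸ 1) + 1)))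
              (k ∸ 2) (a (k ∸ 2) ∸ 1)) (k ∸ 3) (z (k ∸ 3) + 1)
  else if (z k <ᵇ a k) ∧ (a (k ∸ 1) ≤ᵇ z (k ∸ 1)) ∧ (z (k ∸ 1) ≤ᵇ 2 * a (k ∸ 1))
          ∧ (0 <ᵇ z (k ∸ 2))
  then upd (upd (upd z k (z k + 1)) (k ∸ 1) (z (k ∸ 1) ∸ a (k ∸ 1)))
           (k ∸ 2) (z (k ∸ 2) ∸ 1)
  else z

-- Algorithm 1, step k = 3: z_3 from z = z_4
stepB : (ℕ → ℕ) → (ℕ → ℕ) → (ℕ → ℕ)
stepB a z =
  if (z 3 <ᵇ a 3) ∧ (a 2 <ᵇ z 2) ∧ (z 1 ≡ᵇ 0)
  then upd (upd (upd z 3 (z 3 + 1)) 2 (z 2 ∸ (a 2 + 1))) 1 (a 1 ∸ 1)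
  else if (z 3 <ᵇ a 3) ∧ (a 2 ≤ᵇ z 2) ∧ (z 1 ≤ᵇ a 1) ∧ (0 <ᵇ z 1)
  then upd (upd (upd z 3 (z 3 + 1)) 2 (z 2 ∸ a 2)) 1 (z 1 ∸ 1)
  else if (z 3 <ᵇ a 3) ∧ (a 2 ≤ᵇ z 2) ∧ (a 1 <ᵇ z 1)
  then upd (upd (upd z 3 (z 3 + 1)) 2 ((z 2 ∸ a 2) + 1)) 1 ((z 1 ∸ a 1) ∸ 1)
  else if (z 2 <ᵇ a 2) ∧ (a 1 ≤ᵇ z 1)
  then upd (upd z 2 (z 2 + 1)) 1 (z 1 ∸ a 1)
  else z

-- zIter a m s j = z_{m+1-j}  (for j ≤ m - 3), with z_{m+1} = s
zIter : (ℕ → ℕ) → ℕ → (ℕ → ℕ) → ℕ → (ℕ → ℕ)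
zIter a m s zero = s
zIter a m s (suc j) = stepA a (m ∸ j) (zIter a m s j)

-- z_3 (for m ≥ 3)
z3 : (ℕ → ℕ) → ℕ → (ℕ → ℕ) → (ℕ → ℕ)
z3 a m s = stepB a (zIter a m s (m ∸ 3))

-- Algorithm 2, step k (3 ≤ k ≤ m+1): w_k from w = w_{k-1}
stepW : (ℕ → ℕ) → ℕ → (ℕ → ℕ) → (ℕ → ℕ)
stepW a k w =
  if (w k <ᵇ a k) ∧ (w (k ∸ 1) ≡ᵇ a (k ∸ 1)) ∧ (0 <ᵇ w (k ∸ 2))
  then upd (upd (upd w k (w k + 1)) (k ∸ 1) 0) (k ∸ 2) (w (k ∸ 2) ∸ 1)
  else w

-- wIter a m w2 j = w_{2+j}
wIter : (ℕ → ℕ) → ℕ → (ℕ → ℕ) → ℕ → (ℕ → ℕ)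
wIter a m w2 zero = w2
wIter a m w2 (suc j) = stepW a (3 + j) (wIter a m w2 j)

-- w_{m+1} for the input words x, y of length n (m = n + 1)
wFinal : (ℕ → ℕ) → ℕ → (ℕ → ℕ) → (ℕ → ℕ) → (ℕ → ℕ)
wFinal a n x y = wIter a m w2 (m ∸ 1)
  where
    m = suc n
    zz = z3 a m (sumWord n x y)
    w2 : ℕ → ℕ
    w2 i = if i ≤ᵇ m then zz i else 0

module Submission where

-- First, Algorithm 1 turns the digit sum
-- s = x + y into a word z_3 whose entries at positions ≥ 2 are bounded by
-- the partial quotients.  Before step k the entries above k are already
-- bounded, while the two entries just below may still be "over-full"; the
-- record Carry describes how over-full they can be, and the Ostrowski
-- conditions on x and y (packaged as SumPair) show that Carry holds at the
-- start and that every step A1–A3 preserves it (record Inv).  Step B then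
-- bounds positions 2 and 3.  Second, on such a word every step of
-- Algorithm 2 only lowers entries below its top position and keeps the top
-- position bounded.  If the pattern appeared around position 4+t, the steps
-- at 3+t and 4+t must both have idled (otherwise entry 2+t would end below
-- a_{2+t}), so entry 3+t was already ≥ a_{3+t} before step 5+t; that step
-- either empties entry 4+t or leaves entry 3+t final, and both contradict
-- the pattern.

open import Defs
open import Data.Nat using (ℕ; zero; suc; _+_; _*_; _∸_; _≤_; _<_; _≤′_; ≤′-refl; ≤′-step;
  _≤ᵇ_; _<ᵇ_; _≡ᵇ_; z≤n; s≤s; z<s; s<s; s≤s⁻¹; _≤?_; _≟_)
open import Data.Nat.Properties
open import Data.Bool using (Bool; true; false; if_then_else_; _∧_; T)
open import Data.Bool.Properties using (T-∧)
open import Data.Product using (_×_; _,_; ∃-syntax)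
open import Data.Product.Function.NonDependent.Propositional using (_×-⇔_)
open import Data.Sum using (_⊎_; inj₁; inj₂)
open import Data.Empty using (⊥-elim)
open import Function.Bundles using (_⇔_; mk⇔; Equivalence)
open import Function.Construct.Composition using (_⇔-∘_)
open import Relation.Binary.PropositionalEquality
open import Relation.Nullary using (¬_; yes; no)

if-by : ∀ {A Q : Set} (P : A → Set) {c : Bool} {x y : A} →
        T c ⇔ Q → (Q → P x) → (¬ Q → P y) → P (if c then x else y)
if-by P {true}  c⇔Q then-case else-case = then-case (Equivalence.to c⇔Q _)
if-by P {false} c⇔Q then-case else-case = else-case (Equivalence.from c⇔Q)

<ᵇ-⇔ : ∀ m n → T (m <ᵇ n) ⇔ m < n
<ᵇ-⇔ m n = mk⇔ (<ᵇ⇒< m n) <⇒<ᵇ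

≤ᵇ-⇔ : ∀ m n → T (m ≤ᵇ n) ⇔ m ≤ n
≤ᵇ-⇔ m n = mk⇔ (≤ᵇ⇒≤ m n) ≤⇒≤ᵇ

≡ᵇ-⇔ : ∀ m n → T (m ≡ᵇ n) ⇔ m ≡ n
≡ᵇ-⇔ m n = mk⇔ (≡ᵇ⇒≡ m n) (≡⇒≡ᵇ m n)

infixr 2 _∧-⇔_
_∧-⇔_ : ∀ {b c} {P Q : Set} → T b ⇔ P → T c ⇔ Q → T (b ∧ c) ⇔ (P × Q)
b⇔P ∧-⇔ c⇔Q = (b⇔P ×-⇔ c⇔Q) ⇔-∘ T-∧

upd-same : ∀ f p v → upd f p v p ≡ v
upd-same f p v with p ≡ᵇ p | ≡⇒≡ᵇ p p refl
... | true | _ = refl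

upd-diff : ∀ f p v i → i ≢ p → upd f p v i ≡ f i
upd-diff f p v i i≢p with i ≡ᵇ p | ≡ᵇ⇒≡ i p
... | true  | i≡p = ⊥-elim (i≢p (i≡p _))
... | false | _   = refl

above≢ : ∀ d p → suc d + p ≢ p
above≢ d p = ≢-sym (m≢1+n+m p {d})

-- Writing v₂ v₁ v₀ at positions 2+p, 1+p, p: the shape of every step of
-- both algorithms.
upd₃ : (ℕ → ℕ) → ℕ → ℕ → ℕ → ℕ → (ℕ → ℕ)
upd₃ f p v₂ v₁ v₀ = upd (upd (upd f (2 + p) v₂) (1 + p) v₁) p v₀

upd₃-at₂ : ∀ f p v₂ v₁ v₀ → upd₃ f p v₂ v₁ v₀ (2 + p) ≡ v₂
upd₃-at₂ f p v₂ v₁ v₀ =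
  trans (upd-diff (upd (upd f (2 + p) v₂) (1 + p) v₁) p v₀ (2 + p) (above≢ 1 p))
        (trans (upd-diff (upd f (2 + p) v₂) (1 + p) v₁ (2 + p) (above≢ 0 (1 + p)))
               (upd-same f (2 + p) v₂))

upd₃-at₁ : ∀ f p v₂ v₁ v₀ → upd₃ f p v₂ v₁ v₀ (1 + p) ≡ v₁
upd₃-at₁ f p v₂ v₁ v₀ =
  trans (upd-diff (upd (upd f (2 + p) v₂) (1 + p) v₁) p v₀ (1 + p) (above≢ 0 p))
        (upd-same (upd f (2 + p) v₂) (1 + p) v₁)

upd₃-at₀ : ∀ f p v₂ v₁ v₀ → upd₃ f p v₂ v₁ v₀ p ≡ v₀
upd₃-at₀ f p v₂ v₁ v₀ = upd-same (upd (upd f (2 + p) v₂) (1 + p) v₁) p v₀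

upd₃-outside : ∀ f p v₂ v₁ v₀ j → j < p ⊎ 3 + p ≤ j → upd₃ f p v₂ v₁ v₀ j ≡ f j
upd₃-outside f p v₂ v₁ v₀ j out =
  trans (upd-diff (upd (upd f (2 + p) v₂) (1 + p) v₁) p v₀ j (away 0 z<s out))
        (trans (upd-diff (upd f (2 + p) v₂) (1 + p) v₁ j (away 1 (s<s z<s) out))
               (upd-diff f (2 + p) v₂ j (away 2 (s<s (s<s z<s)) out)))
  where
    away : ∀ d → d < 3 → j < p ⊎ 3 + p ≤ j → j ≢ d + p
    away d _   (inj₁ j<p)   = <⇒≢ (≤-trans j<p (m≤n+m p d))
    away d d<3 (inj₂ 3+p≤j) = >⇒≢ (<-≤-trans (+-monoˡ-< p d<3) 3+p≤j)

2*≡+ : ∀ A → 2 * A ≡ A + A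
2*≡+ A = cong (A +_) (+-identityʳ A)

n≤2*n : ∀ A → A ≤ 2 * A
n≤2*n A = m≤m+n A (A + 0)

<⇒+1≤ : ∀ {m n} → m < n → m + 1 ≤ n
<⇒+1≤ {m} {n} m<n = subst (_≤ n) (+-comm 1 m) m<n

pred< : ∀ {u A} → 0 < u → u ≤ A → u ∸ 1 < A
pred< {suc u} _ u≤A = u≤A

∸-carry≤ : ∀ U A → U ≤ suc (2 * A) → U ∸ (A + 1) ≤ A
∸-carry≤ U A U≤ = m≤n+o⇒m∸n≤o U (A + 1) (subst (U ≤_) 2A+1≡ U≤)
  where
    2A+1≡ : suc (2 * A) ≡ (A + 1) + A
    2A+1≡ = trans (cong suc (2*≡+ A)) (cong (_+ A) (+-comm 1 A))

∸-half≤ : ∀ U A → U ≤ 2 * A → U ∸ A ≤ A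
∸-half≤ U A U≤ = m≤n+o⇒m∸n≤o U A (subst (U ≤_) (2*≡+ A) U≤)

∸-half<+1 : ∀ {U A} → A ≤ U → U < 2 * A → U ∸ A + 1 ≤ A
∸-half<+1 {U} {A} A≤U U<2A =
  <⇒+1≤ (subst (U ∸ A <_) (m+n∸n≡m A A) (∸-monoˡ-< (subst (U <_) (2*≡+ A) U<2A) A≤U))

∸-half≡ : ∀ {U A} → A ≤ U → U ∸ A ≡ A → U ≡ 2 * A
∸-half≡ {U} {A} A≤U e = trans (sym (m∸n+n≡m A≤U)) (trans (cong (_+ A) e) (sym (2*≡+ A)))

pair-full : ∀ {u v A} → u ≤ A → v ≤ A → u + v ≡ 2 * A → u ≡ A × v ≡ A
pair-full {A = A} u≤A v≤A e with m≤n⇒m<n∨m≡n u≤A | m≤n⇒m<n∨m≡n v≤A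
... | inj₂ u≡A | inj₂ v≡A = u≡A , v≡A
... | inj₁ u<A | _        = ⊥-elim (<⇒≢ (+-mono-<-≤ u<A v≤A) (trans e (2*≡+ A)))
... | inj₂ _   | inj₁ v<A = ⊥-elim (<⇒≢ (+-mono-≤-< u≤A v<A) (trans e (2*≡+ A)))

pair-max : ∀ {u v A} → u ≤ A → v ≤ A → 2 * A ≤ suc (u + v) → u ≡ A ⊎ v ≡ A
pair-max {u} {v} {A} u≤A v≤A h with m≤n⇒m<n∨m≡n u≤A | m≤n⇒m<n∨m≡n v≤A
... | inj₂ u≡A | _        = inj₁ u≡A
... | inj₁ _   | inj₂ v≡A = inj₂ v≡A
... | inj₁ u<A | inj₁ v<A = ⊥-elim (<⇒≱ sum< h)
  where
    sum< : suc (u + v) < 2 * A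
    sum< = subst₂ _≤_ (cong suc (+-suc u v)) (sym (2*≡+ A)) (+-mono-≤ u<A v<A)

-- An entry u (bound A) above an entry v (bound B) in a sum of two
-- Ostrowski representations: u ≤ 2A, and the Ostrowski condition on both
-- summands keeps v small when u is (nearly) maximal.
record SumPair (u A v B : ℕ) : Set where
  field
    bound : u ≤ 2 * A
    full  : u ≡ 2 * A → v ≡ 0
    near  : 2 * A ≤ suc u → v ≤ B

-- The weaker shape maintained by Algorithm 1, which may add one carry to
-- an entry: u ≤ 2A+1, and the two largest values of u force v to be small.
record Carry (u A v B : ℕ) : Set where
  field
    bound  : u ≤ suc (2 * A)
    full   : u ≡ suc (2 * A) → v ≡ 0
    double : u ≡ 2 * A → v ≤ B

sum⇒carry : ∀ {u A v B} → SumPair u A v B → Carry u A v B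
sum⇒carry {u} {A} s = record
  { bound  = m≤n⇒m≤1+n (SumPair.bound s)
  ; full   = λ u≡ → ⊥-elim (1+n≰n (subst (_≤ 2 * A) u≡ (SumPair.bound s)))
  ; double = λ u≡ → SumPair.near s (subst (λ w → w ≤ suc u) u≡ (n≤1+n u))
  }

sum⇒carry-suc : ∀ {u A v B} → SumPair u A v B → Carry (suc u) A v B
sum⇒carry-suc s = record
  { bound  = s≤s (SumPair.bound s)
  ; full   = λ su≡ → SumPair.full s (suc-injective su≡)
  ; double = λ su≡ → SumPair.near s (≤-reflexive (sym su≡))
  }

carry-small : ∀ {u A v B} → u < 2 * A → Carry u A v B
carry-small u<2A = record
  { bound  = m≤n⇒m≤1+n (<⇒≤ u<2A)
  ; full   = λ u≡ → ⊥-elim (<⇒≢ (m<n⇒m<1+n u<2A) u≡)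
  ; double = λ u≡ → ⊥-elim (<⇒≢ u<2A u≡)
  }

carry-pred : ∀ {u A v B} → 0 < u → Carry u A v B → Carry (u ∸ 1) A v B
carry-pred {suc u} _ c = record
  { bound  = ≤-trans (n≤1+n u) (Carry.bound c)
  ; full   = λ u≡ → ⊥-elim (1+n≰n (subst (λ w → suc w ≤ _) u≡ (Carry.bound c)))
  ; double = λ u≡ → subst (_≤ _) (sym (Carry.full c (cong suc u≡))) z≤n
  }

carry-≤2* : ∀ {u A v B} → Carry u A v B → 0 < v → u ≤ 2 * A
carry-≤2* c 0<v with m≤n⇒m<n∨m≡n (Carry.bound c)
... | inj₁ u<  = s≤s⁻¹ u<
... | inj₂ u≡ = ⊥-elim (>⇒≢ 0<v (Carry.full c u≡))

carry-<2* : ∀ {u A v B} → Carry u A v B → B < v → u < 2 * A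
carry-<2* c B<v with m≤n⇒m<n∨m≡n (carry-≤2* c (≤-<-trans z≤n B<v))
... | inj₁ u<2A = u<2A
... | inj₂ u≡2A = ⊥-elim (<⇒≱ B<v (Carry.double c u≡2A))

module OstrowskiSum (a : ℕ → ℕ) (pos : ∀ i → 1 ≤ i → 1 ≤ a i) (n : ℕ) (x y : ℕ → ℕ)
                    {M N : ℕ} (ox : IsOstrowskiRep a n x M) (oy : IsOstrowskiRep a n y N) where

  S : ℕ → ℕ
  S = sumWord n x y

  S-view : ∀ i → (1 ≤ i × i ≤ n × S i ≡ x i + y i) ⊎ S i ≡ 0
  S-view i = if-by (λ v → (1 ≤ i × i ≤ n × v ≡ x i + y i) ⊎ v ≡ 0) (≤ᵇ-⇔ 1 i ∧-⇔ ≤ᵇ-⇔ i n)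
               (λ { (1≤i , i≤n) → inj₁ (1≤i , i≤n , refl) }) (λ _ → inj₂ refl)

  S-inside : ∀ i → 1 ≤ i → i ≤ n → S i ≡ x i + y i
  S-inside i 1≤i i≤n = if-by (λ v → v ≡ x i + y i) (≤ᵇ-⇔ 1 i ∧-⇔ ≤ᵇ-⇔ i n)
                         (λ _ → refl) (λ outside → ⊥-elim (outside (1≤i , i≤n)))

  S-vanishes : ∀ p → suc n ≤ p → S p ≡ 0
  S-vanishes p n<p with S-view p
  ... | inj₁ (_ , p≤n , _) = ⊥-elim (<⇒≱ n<p p≤n)
  ... | inj₂ S≡0           = S≡0

  S≤ : ∀ i → S i ≤ x i + y i
  S≤ i with S-view i
  ... | inj₁ (_ , _ , e) = ≤-reflexive e
  ... | inj₂ e           = subst (_≤ _) (sym e) z≤n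

  S-bound : ∀ i → S i ≤ 2 * a i
  S-bound i with S-view i
  ... | inj₁ (1≤i , i≤n , e) =
        subst₂ _≤_ (sym e) (sym (2*≡+ (a i)))
          (+-mono-≤ (IsOstrowskiRep.bound ox i 1≤i i≤n) (IsOstrowskiRep.bound oy i 1≤i i≤n))
  ... | inj₂ e = subst (_≤ _) (sym e) z≤n

  sumPair-zero : ∀ {A v B} → 1 ≤ A → SumPair 0 A v B
  sumPair-zero 1≤A = record
    { bound = z≤n
    ; full  = λ 0≡2A → ⊥-elim (<⇒≢ (≤-trans 1≤A (n≤2*n _)) 0≡2A)
    ; near  = λ 2A≤1 → ⊥-elim (1+n≰n (≤-trans (*-monoʳ-≤ 2 1≤A) 2A≤1))
    }

  -- Inside 1..n a (nearly) maximal sum needs a maximal digit of x or y,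
  -- whose Ostrowski condition empties the digit below.
  sumPair : ∀ i → SumPair (S (suc i)) (a (suc i)) (S i) (a i)
  sumPair zero = record { bound = S-bound 1 ; full = λ _ → refl ; near = λ _ → z≤n }
  sumPair (suc i) with 2 + i ≤? n
  ... | no 2+i≰n =
        subst (λ u → SumPair u (a (2 + i)) (S (1 + i)) (a (1 + i)))
          (sym (S-vanishes (2 + i) (≰⇒> 2+i≰n))) (sumPair-zero (pos (2 + i) (s≤s z≤n)))
  ... | yes 2+i≤n = record
    { bound = S-bound (2 + i)
    ; full  = λ S≡2A → let (x≡A , y≡A) = pair-full x≤ y≤ (trans (sym S≡) S≡2A) in
                n≤0⇒n≡0 (subst (S (1 + i) ≤_) (cong₂ _+_ (x-below x≡A) (y-below y≡A)) (S≤ (1 + i)))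
    ; near  = λ 2A≤ → lower (pair-max x≤ y≤ (subst (λ u → 2 * a (2 + i) ≤ suc u) S≡ 2A≤))
    }
    where
      open IsOstrowskiRep
      1+i≤n : 1 + i ≤ n
      1+i≤n = <⇒≤ 2+i≤n
      S≡ : S (2 + i) ≡ x (2 + i) + y (2 + i)
      S≡ = S-inside (2 + i) (s≤s z≤n) 2+i≤n
      x≤ : x (2 + i) ≤ a (2 + i)
      x≤ = bound ox (2 + i) (s≤s z≤n) 2+i≤n
      y≤ : y (2 + i) ≤ a (2 + i)
      y≤ = bound oy (2 + i) (s≤s z≤n) 2+i≤n
      x-below : x (2 + i) ≡ a (2 + i) → x (1 + i) ≡ 0
      x-below = zeroed ox (2 + i) (s≤s (s≤s z≤n)) 2+i≤n
      y-below : y (2 + i) ≡ a (2 + i) → y (1 + i) ≡ 0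
      y-below = zeroed oy (2 + i) (s≤s (s≤s z≤n)) 2+i≤n
      lower : x (2 + i) ≡ a (2 + i) ⊎ y (2 + i) ≡ a (2 + i) → S (1 + i) ≤ a (1 + i)
      lower (inj₁ x≡A) = ≤-trans (S≤ (1 + i))
        (subst (λ u → u + y (1 + i) ≤ _) (sym (x-below x≡A)) (bound oy (1 + i) (s≤s z≤n) 1+i≤n))
      lower (inj₂ y≡A) = ≤-trans (S≤ (1 + i))
        (subst (λ u → x (1 + i) + u ≤ _) (sym (y-below y≡A))
          (subst (_≤ _) (sym (+-identityʳ _)) (bound ox (1 + i) (s≤s z≤n) 1+i≤n)))

module Algorithm1 (a : ℕ → ℕ) (pos : ∀ i → 1 ≤ i → 1 ≤ a i) (S : ℕ → ℕ)
                  (sumPair : ∀ i → SumPair (S (suc i)) (a (suc i)) (S i) (a i)) where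

  -- The state z = z_{4+t}: positions ≥ 3+t are bounded, the two entries
  -- below are at most over-full, and positions ≤ t are still those of S.
  record Inv (t : ℕ) (z : ℕ → ℕ) : Set where
    field
      settled   : ∀ j → 3 + t ≤ j → z j ≤ a j
      guard     : z (3 + t) ≡ a (3 + t) → z (2 + t) < a (2 + t)
      carry₂    : Carry (z (2 + t)) (a (2 + t)) (z (1 + t)) (a (1 + t))
      carry₁    : Carry (z (1 + t)) (a (1 + t)) (z t) (a t)
      untouched : ∀ j → j ≤ t → z j ≡ S j
  open Inv

  inv-start : ∀ t → (∀ p → 3 + t ≤ p → S p ≡ 0) → Inv t S
  inv-start t vanish = record
    { settled   = λ j 3+t≤j → subst (_≤ a j) (sym (vanish j 3+t≤j)) z≤n
    ; guard     = λ S≡a → ⊥-elim (>⇒≢ (pos (3 + t) (s≤s z≤n)) (trans (sym S≡a) (vanish (3 + t) ≤-refl)))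
    ; carry₂    = sum⇒carry (sumPair (1 + t))
    ; carry₁    = sum⇒carry (sumPair t)
    ; untouched = λ _ _ → refl
    }

  inv-step : ∀ {t z z'} → Inv (suc t) z →
    (∀ j → j ≤ t ⊎ 5 + t ≤ j → z' j ≡ z j) →
    z' (4 + t) ≤ a (4 + t) → z' (3 + t) ≤ a (3 + t) →
    (z' (3 + t) ≡ a (3 + t) → z' (2 + t) < a (2 + t)) →
    Carry (z' (2 + t)) (a (2 + t)) (z' (1 + t)) (a (1 + t)) →
    z' (1 + t) ≡ S (1 + t) ⊎ z' (1 + t) ≡ suc (S (1 + t)) →
    Inv t z'
  inv-step {t} {z} {z'} I frame top₄ top₃ grd c₂ bottom = record
    { settled   = settled'
    ; guard     = grd
    ; carry₂    = c₂
    ; carry₁    = subst (λ v → Carry (z' (1 + t)) (a (1 + t)) v (a t)) (sym z't≡) (carry₁' bottom)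
    ; untouched = λ j j≤t → trans (frame j (inj₁ j≤t)) (untouched I j (m≤n⇒m≤1+n j≤t))
    }
    where
      z't≡ : z' t ≡ S t
      z't≡ = trans (frame t (inj₁ ≤-refl)) (untouched I t (n≤1+n t))
      carry₁' : z' (1 + t) ≡ S (1 + t) ⊎ z' (1 + t) ≡ suc (S (1 + t)) →
                Carry (z' (1 + t)) (a (1 + t)) (S t) (a t)
      carry₁' (inj₁ e) = subst (λ u → Carry u (a (1 + t)) (S t) (a t)) (sym e) (sum⇒carry (sumPair t))
      carry₁' (inj₂ e) = subst (λ u → Carry u (a (1 + t)) (S t) (a t)) (sym e) (sum⇒carry-suc (sumPair t))
      settled' : ∀ j → 3 + t ≤ j → z' j ≤ a j
      settled' j 3+t≤j with m≤n⇒m<n∨m≡n 3+t≤j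
      ... | inj₂ refl = top₃
      ... | inj₁ 4+t≤j with m≤n⇒m<n∨m≡n 4+t≤j
      ... | inj₂ refl   = top₄
      ... | inj₁ 5+t≤j = subst (_≤ a j) (sym (frame j (inj₂ 5+t≤j))) (settled I j 4+t≤j)

  top-unsaturated : ∀ {t z} → Inv t z → a (2 + t) ≤ z (2 + t) → z (3 + t) < a (3 + t)
  top-unsaturated {t} I a≤z with m≤n⇒m<n∨m≡n (settled I (3 + t) ≤-refl)
  ... | inj₁ z<a = z<a
  ... | inj₂ z≡a = ⊥-elim (<⇒≱ (guard I z≡a) a≤z)

  -- Case (A1) of step 4+t: a carry from 3+t into 4+t, borrowing through 2+t.
  case-A1 : ∀ {t z} → Inv (suc t) z → z (4 + t) < a (4 + t) →
    Inv t (upd (upd₃ z (2 + t) (z (4 + t) + 1) (z (3 + t) ∸ (a (3 + t) + 1)) (a (2 + t) ∸ 1))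
               (1 + t) (z (1 + t) + 1))
  case-A1 {t} {z} I T<a = inv-step I frame
    (subst (_≤ a (4 + t)) (sym at₃) (<⇒+1≤ T<a))
    (subst (_≤ a (3 + t)) (sym at₂) (∸-carry≤ (z (3 + t)) (a (3 + t)) (Carry.bound (carry₂ I))))
    (λ _ → subst (_< a (2 + t)) (sym at₁) a₂-1<a₂)
    (carry-small (subst (_< 2 * a (2 + t)) (sym at₁) (<-≤-trans a₂-1<a₂ (n≤2*n (a (2 + t))))))
    (inj₂ (trans (upd-same w (1 + t) (z (1 + t) + 1))
                 (trans (+-comm (z (1 + t)) 1) (cong suc (untouched I (1 + t) ≤-refl)))))
    where
      w : ℕ → ℕ
      w = upd₃ z (2 + t) (z (4 + t) + 1) (z (3 + t) ∸ (a (3 + t) + 1)) (a (2 + t) ∸ 1)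
      z' : ℕ → ℕ
      z' = upd w (1 + t) (z (1 + t) + 1)
      past : ∀ j → j ≢ 1 + t → z' j ≡ w j
      past j = upd-diff w (1 + t) (z (1 + t) + 1) j
      at₃ : z' (4 + t) ≡ z (4 + t) + 1
      at₃ = trans (past (4 + t) (above≢ 2 (1 + t))) (upd₃-at₂ z (2 + t) _ _ _)
      at₂ : z' (3 + t) ≡ z (3 + t) ∸ (a (3 + t) + 1)
      at₂ = trans (past (3 + t) (above≢ 1 (1 + t))) (upd₃-at₁ z (2 + t) _ _ _)
      at₁ : z' (2 + t) ≡ a (2 + t) ∸ 1
      at₁ = trans (past (2 + t) (above≢ 0 (1 + t))) (upd₃-at₀ z (2 + t) _ _ _)
      frame : ∀ j → j ≤ t ⊎ 5 + t ≤ j → z' j ≡ z j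
      frame j (inj₁ j≤t)   = trans (past j (<⇒≢ (s≤s j≤t)))
                                   (upd₃-outside z (2 + t) _ _ _ j (inj₁ (s≤s (m≤n⇒m≤1+n j≤t))))
      frame j (inj₂ 5+t≤j) = trans (past j (>⇒≢ (≤-trans (m≤n+m (2 + t) 3) 5+t≤j)))
                                   (upd₃-outside z (2 + t) _ _ _ j (inj₂ 5+t≤j))
      a₂-1<a₂ : a (2 + t) ∸ 1 < a (2 + t)
      a₂-1<a₂ = pred< (pos (2 + t) (s≤s z≤n)) ≤-refl

  -- Case (A2) of step 4+t: a carry from 3+t into 4+t, taking one unit from 2+t.
  case-A2 : ∀ {t z} → Inv (suc t) z → z (4 + t) < a (4 + t) →
    a (3 + t) ≤ z (3 + t) → z (3 + t) ≤ 2 * a (3 + t) → 0 < z (2 + t) →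
    Inv t (upd₃ z (2 + t) (z (4 + t) + 1) (z (3 + t) ∸ a (3 + t)) (z (2 + t) ∸ 1))
  case-A2 {t} {z} I T<a a≤U U≤2a 0<V = inv-step I frame
    (subst (_≤ a (4 + t)) (sym (upd₃-at₂ z (2 + t) _ _ _)) (<⇒+1≤ T<a))
    (subst (_≤ a (3 + t)) (sym at₂) (∸-half≤ (z (3 + t)) (a (3 + t)) U≤2a))
    (λ e → subst (_< a (2 + t)) (sym at₁)
             (pred< 0<V (Carry.double (carry₂ I) (∸-half≡ a≤U (trans (sym at₂) e)))))
    (subst₂ (λ u v → Carry u (a (2 + t)) v (a (1 + t))) (sym at₁) (sym at₀) (carry-pred 0<V (carry₁ I)))
    (inj₁ (trans at₀ (untouched I (1 + t) ≤-refl)))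
    where
      z' : ℕ → ℕ
      z' = upd₃ z (2 + t) (z (4 + t) + 1) (z (3 + t) ∸ a (3 + t)) (z (2 + t) ∸ 1)
      at₂ : z' (3 + t) ≡ z (3 + t) ∸ a (3 + t)
      at₂ = upd₃-at₁ z (2 + t) _ _ _
      at₁ : z' (2 + t) ≡ z (2 + t) ∸ 1
      at₁ = upd₃-at₀ z (2 + t) _ _ _
      at₀ : z' (1 + t) ≡ z (1 + t)
      at₀ = upd₃-outside z (2 + t) _ _ _ (1 + t) (inj₁ ≤-refl)
      frame : ∀ j → j ≤ t ⊎ 5 + t ≤ j → z' j ≡ z j
      frame j (inj₁ j≤t)   = upd₃-outside z (2 + t) _ _ _ j (inj₁ (s≤s (m≤n⇒m≤1+n j≤t)))
      frame j (inj₂ 5+t≤j) = upd₃-outside z (2 + t) _ _ _ j (inj₂ 5+t≤j)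

  case-A3 : ∀ {t z} → Inv (suc t) z →
    ¬ (z (4 + t) < a (4 + t) × a (3 + t) < z (3 + t) × z (2 + t) ≡ 0) →
    ¬ (z (4 + t) < a (4 + t) × a (3 + t) ≤ z (3 + t) × z (3 + t) ≤ 2 * a (3 + t) × 0 < z (2 + t)) →
    Inv t z
  case-A3 {t} {z} I ¬A1 ¬A2 = inv-step I (λ _ _ → refl)
    (settled I (4 + t) ≤-refl) (≮⇒≥ over) grd (carry₁ I) (inj₁ (untouched I (1 + t) ≤-refl))
    where
      -- with a(3+t) ≤ z(3+t), a positive entry at 2+t would trigger A2
      V≡0 : a (3 + t) ≤ z (3 + t) → z (3 + t) ≤ 2 * a (3 + t) → z (2 + t) ≡ 0
      V≡0 a≤U U≤2a with z (2 + t) ≟ 0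
      ... | yes V≡0 = V≡0
      ... | no  V≢0 = ⊥-elim (¬A2 (top-unsaturated I a≤U , a≤U , U≤2a , n≢0⇒n>0 V≢0))
      over : ¬ a (3 + t) < z (3 + t)
      over a<U with z (2 + t) ≟ 0
      ... | yes V≡0 = ¬A1 (top-unsaturated I (<⇒≤ a<U) , a<U , V≡0)
      ... | no  V≢0 = V≢0 (V≡0 (<⇒≤ a<U) (carry-≤2* (carry₂ I) (n≢0⇒n>0 V≢0)))
      grd : z (3 + t) ≡ a (3 + t) → z (2 + t) < a (2 + t)
      grd U≡a = subst (_< a (2 + t)) (sym (V≡0 (≤-reflexive (sym U≡a)) (≤-trans (≤-reflexive U≡a) (n≤2*n _))))
                  (pos (2 + t) (s≤s z≤n))

  stepA-inv : ∀ {t z} → Inv (suc t) z → Inv t (stepA a (4 + t) z)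
  stepA-inv {t} {z} I =
    if-by (Inv t) (<ᵇ-⇔ _ _ ∧-⇔ <ᵇ-⇔ _ _ ∧-⇔ ≡ᵇ-⇔ _ _)
      (λ { (T<a , _) → case-A1 I T<a })
      (λ ¬A1 → if-by (Inv t) (<ᵇ-⇔ _ _ ∧-⇔ ≤ᵇ-⇔ _ _ ∧-⇔ ≤ᵇ-⇔ _ _ ∧-⇔ <ᵇ-⇔ _ _)
        (λ { (T<a , a≤U , U≤2a , 0<V) → case-A2 I T<a a≤U U≤2a 0<V })
        (case-A3 I ¬A1))

  iterate-inv : ∀ t j → (∀ p → 3 + (t + j) ≤ p → S p ≡ 0) → Inv t (zIter a (3 + (t + j)) S j)
  iterate-inv t zero    vanish = inv-start t (λ p h → vanish p (subst (λ s → 3 + s ≤ p) (sym (+-identityʳ t)) h))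
  iterate-inv t (suc j) vanish = subst (λ s → Inv t (zIter a (3 + s) S (suc j))) (sym (+-suc t j)) stepped
    where
      stepped : Inv t (zIter a (4 + (t + j)) S (suc j))
      stepped = subst (λ k → Inv t (stepA a k (zIter a (4 + (t + j)) S j))) (sym (m+n∸n≡m (4 + t) j))
                  (stepA-inv (iterate-inv (suc t) j
                    (λ p h → vanish p (subst (λ s → 3 + s ≤ p) (sym (+-suc t j)) h))))

  -- z₄, the input of step B, for a word vanishing from position m on
  -- (for m ≤ 3 no step A is performed and z₄ = S).
  z₄-inv : ∀ m → (∀ p → m ≤ p → S p ≡ 0) → Inv 0 (zIter a m S (m ∸ 3))
  z₄-inv zero                vanish = inv-start 0 (λ p _ → vanish p z≤n)
  z₄-inv (suc zero)          vanish = inv-start 0 (λ p h → vanish p (≤-trans (s≤s z≤n) h))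
  z₄-inv (suc (suc zero))    vanish = inv-start 0 (λ p h → vanish p (≤-trans (s≤s (s≤s z≤n)) h))
  z₄-inv (suc (suc (suc j))) vanish = iterate-inv 0 j vanish

  Admissible₂ : (ℕ → ℕ) → Set
  Admissible₂ w = ∀ j → 2 ≤ j → w j ≤ a j

  -- Positions 2 and 3 are the only ones step B may push over their bound.
  admissible-from : ∀ {z w} → Inv 0 z → (∀ j → 4 ≤ j → w j ≡ z j) →
                    w 2 ≤ a 2 → w 3 ≤ a 3 → Admissible₂ w
  admissible-from I agree w₂≤ w₃≤ j 2≤j with m≤n⇒m<n∨m≡n 2≤j
  ... | inj₂ refl = w₂≤
  ... | inj₁ 3≤j with m≤n⇒m<n∨m≡n 3≤j
  ... | inj₂ refl = w₃≤
  ... | inj₁ 4≤j = subst (_≤ a j) (sym (agree j 4≤j)) (settled I j 3≤j)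

  carry-into-3 : ∀ {z} → Inv 0 z → z 3 < a 3 →
                 ∀ {v₁} v₀ → v₁ ≤ a 2 → Admissible₂ (upd₃ z 1 (z 3 + 1) v₁ v₀)
  carry-into-3 {z} I z₃<a {v₁} v₀ v₁≤ = admissible-from I
    (λ j 4≤j → upd₃-outside z 1 _ _ v₀ j (inj₂ 4≤j))
    (subst (_≤ a 2) (sym (upd₃-at₁ z 1 (z 3 + 1) _ v₀)) v₁≤)
    (subst (_≤ a 3) (sym (upd₃-at₂ z 1 _ v₁ v₀)) (<⇒+1≤ z₃<a))

  case-B4 : ∀ {z} → Inv 0 z → z 2 < a 2 → ∀ v₀ → Admissible₂ (upd (upd z 2 (z 2 + 1)) 1 v₀)
  case-B4 {z} I z₂<a v₀ = admissible-from I (λ j 4≤j → below₃ j (<⇒≤ 4≤j))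
    (subst (_≤ a 2) (sym (trans (upd-diff (upd z 2 (z 2 + 1)) 1 v₀ 2 (above≢ 0 1)) (upd-same z 2 (z 2 + 1))))
      (<⇒+1≤ z₂<a))
    (subst (_≤ a 3) (sym (below₃ 3 ≤-refl)) (settled I 3 ≤-refl))
    where
      below₃ : ∀ j → 3 ≤ j → upd (upd z 2 (z 2 + 1)) 1 v₀ j ≡ z j
      below₃ j 3≤j = trans (upd-diff (upd z 2 (z 2 + 1)) 1 v₀ j (>⇒≢ (≤-trans (s≤s (s≤s z≤n)) 3≤j)))
                           (upd-diff z 2 (z 2 + 1) j (>⇒≢ 3≤j))

  case-B5 : ∀ {z} → Inv 0 z →
    ¬ (z 3 < a 3 × a 2 < z 2 × z 1 ≡ 0) →
    ¬ (z 3 < a 3 × a 2 ≤ z 2 × z 1 ≤ a 1 × 0 < z 1) →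
    ¬ (z 3 < a 3 × a 2 ≤ z 2 × a 1 < z 1) →
    Admissible₂ z
  case-B5 {z} I ¬B1 ¬B2 ¬B3 = admissible-from I (λ _ _ → refl) (≮⇒≥ over) (settled I 3 ≤-refl)
    where
      over : ¬ a 2 < z 2
      over a<z₂ with z 1 ≟ 0 | z 1 ≤? a 1
      ... | yes z₁≡0 | _        = ¬B1 (top-unsaturated I (<⇒≤ a<z₂) , a<z₂ , z₁≡0)
      ... | no  z₁≢0 | yes z₁≤a = ¬B2 (top-unsaturated I (<⇒≤ a<z₂) , <⇒≤ a<z₂ , z₁≤a , n≢0⇒n>0 z₁≢0)
      ... | no  _    | no  z₁≰a = ¬B3 (top-unsaturated I (<⇒≤ a<z₂) , <⇒≤ a<z₂ , ≰⇒> z₁≰a)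

  stepB-admissible : ∀ {z} → Inv 0 z → Admissible₂ (stepB a z)
  stepB-admissible {z} I =
    if-by Admissible₂ (<ᵇ-⇔ _ _ ∧-⇔ <ᵇ-⇔ _ _ ∧-⇔ ≡ᵇ-⇔ _ _)
      (λ { (z₃<a , _) → carry-into-3 I z₃<a _ (∸-carry≤ (z 2) (a 2) (Carry.bound c₂)) })
      λ ¬B1 → if-by Admissible₂ (<ᵇ-⇔ _ _ ∧-⇔ ≤ᵇ-⇔ _ _ ∧-⇔ ≤ᵇ-⇔ _ _ ∧-⇔ <ᵇ-⇔ _ _)
      (λ { (z₃<a , _ , _ , 0<z₁) → carry-into-3 I z₃<a _ (∸-half≤ (z 2) (a 2) (carry-≤2* c₂ 0<z₁)) })
      λ ¬B2 → if-by Admissible₂ (<ᵇ-⇔ _ _ ∧-⇔ ≤ᵇ-⇔ _ _ ∧-⇔ <ᵇ-⇔ _ _)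
      (λ { (z₃<a , a≤z₂ , a<z₁) → carry-into-3 I z₃<a _ (∸-half<+1 a≤z₂ (carry-<2* c₂ a<z₁)) })
      λ ¬B3 → if-by Admissible₂ (<ᵇ-⇔ (z 2) (a 2) ∧-⇔ ≤ᵇ-⇔ (a 1) (z 1))
      (λ { (z₂<a , _) → case-B4 I z₂<a _ })
      (λ _ → case-B5 I ¬B1 ¬B2 ¬B3)
    where
      c₂ : Carry (z 2) (a 2) (z 1) (a 1)
      c₂ = carry₂ I

  z₃-admissible : ∀ m → (∀ p → m ≤ p → S p ≡ 0) → Admissible₂ (z3 a m S)
  z₃-admissible m vanish = stepB-admissible (z₄-inv m vanish)

module Algorithm2 (a : ℕ → ℕ) (pos : ∀ i → 1 ≤ i → 1 ≤ a i) (m : ℕ) (w₂ : ℕ → ℕ)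
                  (w₂-admissible : ∀ p → 2 ≤ p → w₂ p ≤ a p) where

  -- W i = w_{2+i}
  W : ℕ → (ℕ → ℕ)
  W = wIter a m w₂

  -- The guard of step 3+i, which acts on positions 3+i, 2+i, 1+i.
  Fires : ℕ → (ℕ → ℕ) → Set
  Fires i w = w (3 + i) < a (3 + i) × w (2 + i) ≡ a (2 + i) × 0 < w (1 + i)

  data Step (i : ℕ) (w : ℕ → ℕ) : (ℕ → ℕ) → Set where
    fires : Fires i w → Step i w (upd₃ w (1 + i) (w (3 + i) + 1) 0 (w (1 + i) ∸ 1))
    idles : ¬ Fires i w → Step i w w

  step : ∀ i → Step i (W i) (W (suc i))
  step i = if-by (Step i (W i)) (<ᵇ-⇔ _ _ ∧-⇔ ≡ᵇ-⇔ _ _ ∧-⇔ <ᵇ-⇔ _ _) fires idles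

  step-frame : ∀ {i w w'} → Step i w w' → ∀ p → p < 1 + i ⊎ 4 + i ≤ p → w' p ≡ w p
  step-frame {i} {w} (fires _) p out = upd₃-outside w (1 + i) _ _ _ p out
  step-frame (idles _)         p out = refl

  step-noninc : ∀ {i w w'} → Step i w w' → ∀ p → p ≤ 2 + i → w' p ≤ w p
  step-noninc (idles _) p _ = ≤-refl
  step-noninc {i} {w} (fires _) p p≤2+i with m≤n⇒m<n∨m≡n p≤2+i
  ... | inj₂ refl = subst (_≤ w (2 + i)) (sym (upd₃-at₁ w (1 + i) _ _ _)) z≤n
  ... | inj₁ p<2+i with m≤n⇒m<n∨m≡n (s≤s⁻¹ p<2+i)
  ... | inj₂ refl   = subst (_≤ w (1 + i)) (sym (upd₃-at₀ w (1 + i) _ _ _)) (m∸n≤m (w (1 + i)) 1)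
  ... | inj₁ p<1+i = ≤-reflexive (upd₃-outside w (1 + i) _ _ _ p (inj₁ p<1+i))

  step-top : ∀ {i w w'} → Step i w w' → w (3 + i) ≤ a (3 + i) → w' (3 + i) ≤ a (3 + i)
  step-top {i} {w} (fires (w₃<a , _)) _ = subst (_≤ a (3 + i)) (sym (upd₃-at₂ w (1 + i) _ _ _)) (<⇒+1≤ w₃<a)
  step-top (idles _) w₃≤a = w₃≤a

  fired-middle : ∀ {i w w'} → Step i w w' → Fires i w → w' (2 + i) ≡ 0
  fired-middle {i} {w} (fires _) _ = upd₃-at₁ w (1 + i) _ _ _
  fired-middle (idles ¬f) f = ⊥-elim (¬f f)

  fired-bottom : ∀ {i w w'} → Step i w w' → Fires i w → w' (1 + i) ≡ w (1 + i) ∸ 1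
  fired-bottom {i} {w} (fires _) _ = upd₃-at₀ w (1 + i) _ _ _
  fired-bottom (idles ¬f) f = ⊥-elim (¬f f)

  idle : ∀ {i w w'} → Step i w w' → ¬ Fires i w → w' ≡ w
  idle (fires f) ¬f = ⊥-elim (¬f f)
  idle (idles _) _  = refl

  W-ahead : ∀ i p → 3 + i ≤ p → W i p ≡ w₂ p
  W-ahead zero    p _   = refl
  W-ahead (suc i) p 4+i≤p =
    trans (step-frame (step i) p (inj₂ 4+i≤p)) (W-ahead i p (≤-trans (n≤1+n (3 + i)) 4+i≤p))

  W-final : ∀ {i j} p → i ≤′ j → p ≤ i → W j p ≡ W i p
  W-final p ≤′-refl _ = refl
  W-final p (≤′-step i≤j) p≤i =
    trans (step-frame (step _) p (inj₁ (s≤s (≤-trans p≤i (≤′⇒≤ i≤j))))) (W-final p i≤j p≤i)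

  W-noninc : ∀ {i j} p → i ≤′ j → p ≤ 2 + i → W j p ≤ W i p
  W-noninc p ≤′-refl _ = ≤-refl
  W-noninc p (≤′-step i≤j) p≤2+i =
    ≤-trans (step-noninc (step _) p (≤-trans p≤2+i (+-monoʳ-≤ 2 (≤′⇒≤ i≤j)))) (W-noninc p i≤j p≤2+i)

  W-top : ∀ i → W i (2 + i) ≤ a (2 + i)
  W-top zero    = w₂-admissible 2 ≤-refl
  W-top (suc i) = step-top (step i)
    (subst (_≤ a (3 + i)) (sym (W-ahead i (3 + i) ≤-refl)) (w₂-admissible (3 + i) (s≤s (s≤s z≤n))))

  fired-empties : ∀ {i j} → suc i ≤′ j → Fires i (W i) → W j (2 + i) ≡ 0
  fired-empties {i} {j} h f =
    n≤0⇒n≡0 (subst (W j (2 + i) ≤_) (fired-middle (step i) f) (W-noninc (2 + i) h (n≤1+n (2 + i))))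

  fired-deficient : ∀ {t j} → 2 + t ≤′ j → Fires (1 + t) (W (1 + t)) → W j (2 + t) < a (2 + t)
  fired-deficient {t} h f@(_ , _ , 0<v) =
    ≤-<-trans (W-noninc (2 + t) h (m≤n+m (2 + t) 2))
      (subst (_< a (2 + t)) (sym (fired-bottom (step (1 + t)) f))
        (pred< 0<v (≤-trans (step-noninc (step t) (2 + t) ≤-refl) (W-top t))))

  no-pattern : ∀ t j → 2 + t ≤ j →
    ¬ (W j (4 + t) ≡ a (4 + t) × W j (3 + t) < a (3 + t) × W j (2 + t) ≡ a (2 + t) × 0 < W j (1 + t))
  no-pattern t j 2+t≤j (f₄ , f₃ , f₂ , f₁) = <⇒≱ f₃ a≤final
    where
      2+t≤′j : 2 + t ≤′ j
      2+t≤′j = ≤⇒≤′ 2+t≤j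
      t≤′j : t ≤′ j
      t≤′j = ≤⇒≤′ (≤-trans (m≤n+m t 2) 2+t≤j)
      -- steps 3+t and 4+t idle: either firing would spoil entry 2+t
      idle₀ : ¬ Fires t (W t)
      idle₀ f = >⇒≢ (pos (2 + t) (s≤s z≤n))
                  (trans (sym f₂) (fired-empties (≤⇒≤′ (≤-trans (n≤1+n (1 + t)) 2+t≤j)) f))
      idle₁ : ¬ Fires (1 + t) (W (1 + t))
      idle₁ f = <-irrefl f₂ (fired-deficient 2+t≤′j f)
      -- so step 3+t found entries 2+t and 1+t as in the final word, hence entry 3+t saturated
      a≤mid : a (3 + t) ≤ W (2 + t) (3 + t)
      a≤mid = subst (λ w → a (3 + t) ≤ w (3 + t))
                (sym (trans (idle (step (1 + t)) idle₁) (idle (step t) idle₀)))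
                (≮⇒≥ (λ lt → idle₀ (lt , mid , low)))
        where
          mid : W t (2 + t) ≡ a (2 + t)
          mid = ≤-antisym (W-top t) (subst (_≤ W t (2 + t)) f₂ (W-noninc (2 + t) t≤′j ≤-refl))
          low : 0 < W t (1 + t)
          low = <-≤-trans f₁ (W-noninc (1 + t) t≤′j (n≤1+n (1 + t)))
      -- step 5+t, if performed, idles (firing would empty entry 4+t), so entry 3+t is final
      a≤final : a (3 + t) ≤ W j (3 + t)
      a≤final with m≤n⇒m<n∨m≡n 2+t≤j
      ... | inj₂ refl  = a≤mid
      ... | inj₁ 3+t≤j = subst (a (3 + t) ≤_)
              (sym (trans (W-final (3 + t) (≤⇒≤′ 3+t≤j) ≤-refl)
                          (cong (λ w → w (3 + t)) (idle (step (2 + t)) idle₂))))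
              a≤mid
        where
          idle₂ : ¬ Fires (2 + t) (W (2 + t))
          idle₂ f = >⇒≢ (pos (4 + t) (s≤s z≤n)) (trans (sym f₄) (fired-empties (≤⇒≤′ 3+t≤j) f))

window-fits : ∀ {t n} → 4 + t ≤ suc n + 1 → 2 + t ≤ n
window-fits {t} {n} h = s≤s⁻¹ (subst (3 + t ≤_) (+-comm n 1) (s≤s⁻¹ h))

mainTheorem7 : (a : ℕ → ℕ) → (∀ i → 1 ≤ i → 1 ≤ a i) →
    (n M N : ℕ) (x y : ℕ → ℕ) →
    IsOstrowskiRep a n x M → IsOstrowskiRep a n y N →
    ¬ (∃[ k ] (4 ≤ k × k ≤ suc n + 1 ×
         wFinal a n x y k ≡ a k ×
         wFinal a n x y (k ∸ 1) < a (k ∸ 1) ×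
         wFinal a n x y (k ∸ 2) ≡ a (k ∸ 2) ×
         0 < wFinal a n x y (k ∸ 3)))
mainTheorem7 a pos n M N x y ox oy
  (suc (suc (suc (suc t))) , s≤s (s≤s (s≤s (s≤s _))) , k≤ , seen) =
  no-pattern t n (window-fits k≤) seen
  where
    open OstrowskiSum a pos n x y ox oy using (S; sumPair; S-vanishes)
    -- w₂ exactly as in wFinal: z₃ cut off above position m = n + 1
    w₂ : ℕ → ℕ
    w₂ i = if i ≤ᵇ suc n then z3 a (suc n) S i else 0
    w₂-admissible : ∀ p → 2 ≤ p → w₂ p ≤ a p
    w₂-admissible p 2≤p with p ≤ᵇ suc n
    ... | true  = Algorithm1.z₃-admissible a pos S sumPair (suc n) S-vanishes p 2≤p
    ... | false = z≤n
    open Algorithm2 a pos (suc n) w₂ w₂-admissible using (no-pattern)
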